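{- Let $t$ be a positive integer, let $D=(V,A)$ be a $P_{t+1,2}$-free digraph and let $v\in V$. Then each vertex $u\in V_2(v)\setminus\{v\}$ has at most $d^+(v)-\tau(v)+t$ successors in $V_1(v)$.
   Context: All digraphs are strict: no loops and no parallel arcs (opposite arcs $uv,vu$ allowed). $P_{t+1,2}$ denotes the digraph consisting of $t+1$ directed paths of length 2 with the same initial vertex and the same terminal vertex (vertices $x,y,z_1,\dots,z_{t+1}$ all distinct, arcs $xz_i$, $z_iy$); $D$ is $P_{t+1,2}$-free if it has no subdigraph isomorphic to it. For $v\in V$: $N^+(v)=\{x: vx\in A\}$, $N^-(v)=\{x: xv\in A\}$, $d^+(v)=|N^+(v)|$, $V_1(v)=N^+(v)$, $V_2(v)=V\setminus V_1(v)$, and $\tau(v)=|N^+(v)\cap N^-(v)|$. -}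

module Defs where

open import Data.Nat using (ℕ; suc)
open import Data.Bool using (Bool; true; false; T)
open import Data.Fin using (Fin)
open import Data.Fin.Subset using (Subset; _∩_; ∣_∣)
open import Data.Vec using (tabulate)
open import Data.Product using (Σ; _×_)
open import Relation.Binary.PropositionalEquality using (_≡_; _≢_)
open import Relation.Nullary using (¬_)
open import Function.Definitions using (Injective)

-- Parallel arcs are
-- impossible by construction; opposite arcs uv, vu are allowed.
record Digraph (n : ℕ) : Set where
  field
    arc     : Fin n → Fin n → Bool
    loopless : ∀ v → arc v v ≡ false
open Digraph public

N⁺ : ∀ {n} → Digraph n → Fin n → Subset n
N⁺ D v = tabulate (λ x → arc D v x)

N⁻ : ∀ {n} → Digraph n → Fin n → Subset n
N⁻ D v = tabulate (λ x → arc D x v)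

d⁺ : ∀ {n} → Digraph n → Fin n → ℕ
d⁺ D v = ∣ N⁺ D v ∣

τ : ∀ {n} → Digraph n → Fin n → ℕ
τ D v = ∣ N⁺ D v ∩ N⁻ D v ∣

Arc : ∀ {n} → Digraph n → Fin n → Fin n → Set
Arc D u v = T (arc D u v)

HasP2 : ∀ {n} → ℕ → Digraph n → Set
HasP2 {n} k D =
  Σ (Fin n) λ x → Σ (Fin n) λ y → Σ (Fin k → Fin n) λ z →
    x ≢ y × Injective _≡_ _≡_ z ×
    (∀ i → z i ≢ x) × (∀ i → z i ≢ y) ×
    (∀ i → Arc D x (z i)) × (∀ i → Arc D (z i) y)

P2Free : ∀ {n} → ℕ → Digraph n → Set
P2Free k D = ¬ HasP2 k D

-- A vertex z ∈ N⁺(u) ∩ N⁻(v) is the middle of a path u → z → v, so P_{t+1,2}-freeness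
-- bounds |N⁺(u) ∩ N⁻(v)| by t whenever u ≠ v. Inclusion–exclusion inside N⁺(v) gives
-- |N⁺(u) ∩ N⁺(v)| + |N⁺(v) ∩ N⁻(v)| ≤ |N⁺(v)| + |N⁺(u) ∩ N⁺(v) ∩ N⁻(v)|,
-- and the last set lies in N⁺(u) ∩ N⁻(v).
module Submission where

open import Defs
open import Data.Nat using (ℕ; zero; suc; _+_; _≤_; s≤s)
open import Data.Nat.Properties using (+-suc; +-mono-≤; +-monoʳ-≤; ≤-trans; ≮⇒≥; module ≤-Reasoning)
open import Data.Fin using (Fin; zero; suc)
open import Data.Fin.Properties using (suc-injective)
open import Data.Fin.Subset using (Subset; inside; outside; _∈_; _⊆_; _∩_; _∪_; ∣_∣)
open import Data.Fin.Subset.Properties using (p⊆q⇒∣p∣≤∣q∣; x∈p∩q⁺; x∈p∩q⁻; x∈p∪q⁻; p∩q⊆p; p∩q⊆q)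
open import Data.Bool using (Bool; T; not)
open import Data.Bool.Properties using (T-≡)
open import Data.Vec using ([]; _∷_; tabulate; here; there)
open import Data.Vec.Properties using (lookup∘tabulate; []=⇒lookup)
open import Data.Product using (Σ; _×_; _,_; proj₁; proj₂)
open import Data.Sum using ([_,_]′)
open import Function using (Equivalence)
open import Function.Definitions using (Injective)
open import Relation.Binary.PropositionalEquality using (_≡_; _≢_; refl; sym; trans; cong; subst; ≢-sym)

private
  variable
    n : ℕ

∣p∪q∣+∣p∩q∣≡∣p∣+∣q∣ : (p q : Subset n) → ∣ p ∪ q ∣ + ∣ p ∩ q ∣ ≡ ∣ p ∣ + ∣ q ∣
∣p∪q∣+∣p∩q∣≡∣p∣+∣q∣ []            []            = refl
∣p∪q∣+∣p∩q∣≡∣p∣+∣q∣ (inside  ∷ p) (inside  ∷ q) =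
  cong suc (trans (+-suc ∣ p ∪ q ∣ ∣ p ∩ q ∣)
                  (trans (cong suc (∣p∪q∣+∣p∩q∣≡∣p∣+∣q∣ p q)) (sym (+-suc ∣ p ∣ ∣ q ∣))))
∣p∪q∣+∣p∩q∣≡∣p∣+∣q∣ (inside  ∷ p) (outside ∷ q) = cong suc (∣p∪q∣+∣p∩q∣≡∣p∣+∣q∣ p q)
∣p∪q∣+∣p∩q∣≡∣p∣+∣q∣ (outside ∷ p) (inside  ∷ q) =
  trans (cong suc (∣p∪q∣+∣p∩q∣≡∣p∣+∣q∣ p q)) (sym (+-suc ∣ p ∣ ∣ q ∣))
∣p∪q∣+∣p∩q∣≡∣p∣+∣q∣ (outside ∷ p) (outside ∷ q) = ∣p∪q∣+∣p∩q∣≡∣p∣+∣q∣ p q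

∣p∩q∣+∣q∩r∣≤∣q∣+∣p∩r∣ : (p q r : Subset n) → ∣ p ∩ q ∣ + ∣ q ∩ r ∣ ≤ ∣ q ∣ + ∣ p ∩ r ∣
∣p∩q∣+∣q∩r∣≤∣q∣+∣p∩r∣ p q r = begin
  ∣ p ∩ q ∣ + ∣ q ∩ r ∣
    ≡⟨ sym (∣p∪q∣+∣p∩q∣≡∣p∣+∣q∣ (p ∩ q) (q ∩ r)) ⟩
  ∣ (p ∩ q) ∪ (q ∩ r) ∣ + ∣ (p ∩ q) ∩ (q ∩ r) ∣
    ≤⟨ +-mono-≤ (p⊆q⇒∣p∣≤∣q∣ union⊆q) (p⊆q⇒∣p∣≤∣q∣ inter⊆p∩r) ⟩
  ∣ q ∣ + ∣ p ∩ r ∣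
    ∎
  where
  open ≤-Reasoning

  union⊆q : (p ∩ q) ∪ (q ∩ r) ⊆ q
  union⊆q x∈ = [ p∩q⊆q p q , p∩q⊆p q r ]′ (x∈p∪q⁻ (p ∩ q) (q ∩ r) x∈)

  inter⊆p∩r : (p ∩ q) ∩ (q ∩ r) ⊆ p ∩ r
  inter⊆p∩r x∈ with x∈p∩q⁻ (p ∩ q) (q ∩ r) x∈
  ... | x∈p∩q , x∈q∩r = x∈p∩q⁺ (p∩q⊆p p q x∈p∩q , p∩q⊆q q r x∈q∩r)

k≤∣p∣⇒injection : ∀ {k} (p : Subset n) → k ≤ ∣ p ∣ →
  Σ (Fin k → Fin n) λ z → Injective _≡_ _≡_ z × (∀ i → z i ∈ p)
k≤∣p∣⇒injection {k = zero} p _ = (λ ()) , (λ { {()} }) , (λ ())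
k≤∣p∣⇒injection {k = suc k} (outside ∷ p) k<∣p∣
  with z , z-injective , z∈p ← k≤∣p∣⇒injection p k<∣p∣ =
  (λ i → suc (z i)) , (λ e → z-injective (suc-injective e)) , (λ i → there (z∈p i))
k≤∣p∣⇒injection {k = suc k} (inside ∷ p) (s≤s k≤∣p∣)
  with z , z-injective , z∈p ← k≤∣p∣⇒injection p k≤∣p∣ = z′ , z′-injective , z′∈p
  where
  z′ : Fin (suc k) → Fin (suc _)
  z′ zero    = zero
  z′ (suc i) = suc (z i)

  z′-injective : Injective _≡_ _≡_ z′
  z′-injective {zero}  {zero}  _ = refl
  z′-injective {suc i} {suc j} e = cong suc (z-injective (suc-injective e))

  z′∈p : ∀ i → z′ i ∈ inside ∷ p
  z′∈p zero    = here
  z′∈p (suc i) = there (z∈p i)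

∈-tabulate⁻ : ∀ {f : Fin n → Bool} {x} → x ∈ tabulate f → T (f x)
∈-tabulate⁻ {f = f} {x} x∈ =
  Equivalence.from T-≡ (trans (sym (lookup∘tabulate f x)) ([]=⇒lookup x∈))

Arc⇒≢ : (D : Digraph n) {x y : Fin n} → Arc D x y → x ≢ y
Arc⇒≢ D {x} xy refl = subst T (loopless D x) xy

module _ (D : Digraph n) {x y : Fin n} where

  N⁺∩N⁻⇒HasP2 : ∀ {k} → x ≢ y → k ≤ ∣ N⁺ D x ∩ N⁻ D y ∣ → HasP2 k D
  N⁺∩N⁻⇒HasP2 x≢y k≤∣N⁺∩N⁻∣
    with z , z-injective , z∈ ← k≤∣p∣⇒injection (N⁺ D x ∩ N⁻ D y) k≤∣N⁺∩N⁻∣ =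
    x , y , z , x≢y , z-injective ,
    (λ i → ≢-sym (Arc⇒≢ D (x→z i))) , (λ i → Arc⇒≢ D (z→y i)) , x→z , z→y
    where
    x→z : ∀ i → Arc D x (z i)
    x→z i = ∈-tabulate⁻ (proj₁ (x∈p∩q⁻ (N⁺ D x) (N⁻ D y) (z∈ i)))

    z→y : ∀ i → Arc D (z i) y
    z→y i = ∈-tabulate⁻ (proj₂ (x∈p∩q⁻ (N⁺ D x) (N⁻ D y) (z∈ i)))

  P2Free⇒∣N⁺∩N⁻∣≤ : ∀ {t} → P2Free (suc t) D → x ≢ y → ∣ N⁺ D x ∩ N⁻ D y ∣ ≤ t
  P2Free⇒∣N⁺∩N⁻∣≤ free x≢y = ≮⇒≥ λ t<∣N⁺∩N⁻∣ → free (N⁺∩N⁻⇒HasP2 x≢y t<∣N⁺∩N⁻∣)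

lemma2p3 : (t : ℕ) → 1 ≤ t → (n : ℕ) → (D : Digraph n) → P2Free (suc t) D →
    (v u : Fin n) → T (not (arc D v u)) → u ≢ v →
    ∣ N⁺ D u ∩ N⁺ D v ∣ + τ D v ≤ d⁺ D v + t
lemma2p3 t _ n D free v u _ u≢v =
  ≤-trans (∣p∩q∣+∣q∩r∣≤∣q∣+∣p∩r∣ (N⁺ D u) (N⁺ D v) (N⁻ D v))
          (+-monoʳ-≤ (d⁺ D v) (P2Free⇒∣N⁺∩N⁻∣≤ D free u≢v))
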